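{- Let $n$ and $k \ge 5$ be positive integers. There exists an algorithm in the fixed-threshold adaptive model that, for every $x\in\{0,1\}^n$, computes $MAJ_n(x)$ using at most $2\left(\frac{n}{k-4}+1\right)(\log_2 k + 4)$ queries to the oracle.
   Context: For $x\in\{0,1\}^n$, $MAJ_n(x) = [x_1+\cdots+x_n \ge n/2]$, where $[P]=1$ if $P$ holds and $0$ otherwise. For $S\subseteq\{1,\ldots,n\}$ let $sum_S(x)=\sum_{i\in S}x_i$ and $MAJ_S(x) = [sum_S(x) \ge |S|/2]$. In the fixed-threshold adaptive model an algorithm has access to an oracle that knows the hidden vector $x$; a query is a set $S\subseteq\{1,\ldots,n\}$ with $|S|\le k$, and the oracle answers $MAJ_S(x)$. -}

module Defs where

open import Data.Bool using (Bool; true; false; _∧_)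
open import Data.Nat using (ℕ; zero; suc; _+_; _*_; _∸_; _^_; _≤_; _≤ᵇ_)
open import Data.Vec using (Vec; []; _∷_)
open import Data.Fin.Subset using (Subset; ∣_∣; ⊤)

sumS : ∀ {n} → Subset n → Vec Bool n → ℕ
sumS [] [] = 0
sumS (true ∷ S) (true ∷ x) = suc (sumS S x)
sumS (_ ∷ S) (_ ∷ x) = sumS S x

-- MAJ_S(x) = [ sum_S(x) ≥ |S|/2 ]  ⇔  [ |S| ≤ 2 · sum_S(x) ]
MAJS : ∀ {n} → Subset n → Vec Bool n → Bool
MAJS S x = ∣ S ∣ ≤ᵇ 2 * sumS S x

MAJ : ∀ {n} → Vec Bool n → Bool
MAJ x = MAJS ⊤ x

-- Deterministic adaptive algorithms in the fixed-threshold model with query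
-- size bound k are exactly decision trees: each internal node queries a set S
-- with |S| ≤ k and branches on the oracle answer MAJ_S(x); leaves output.
data Algorithm (n k : ℕ) : Set where
  output : Bool → Algorithm n k
  query  : (S : Subset n) → ∣ S ∣ ≤ k →
           (ifFalse : Algorithm n k) → (ifTrue : Algorithm n k) → Algorithm n k

run : ∀ {n k} → Algorithm n k → Vec Bool n → Bool
run (output b) x = b
run (query S _ f t) x with MAJS S x
... | false = run f x
... | true  = run t x

queries : ∀ {n k} → Algorithm n k → Vec Bool n → ℕ
queries (output b) x = 0
queries (query S _ f t) x with MAJS S x
... | false = suc (queries f x)
... | true  = suc (queries t x)

-- WithinBound n k q  ⇔  q ≤ 2 (n/(k-4) + 1)(log₂ k + 4)   (for k ≥ 5).
-- With d = k - 4 > 0 the real bound equals (2(n+d)/d) · log₂(16k), so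
-- q ≤ bound  ⇔  q·d ≤ 2(n+d) · log₂(16k)  ⇔  2^(q·d) ≤ (16k)^(2(n+d)).
WithinBound : ℕ → ℕ → ℕ → Set
WithinBound n k q = 2 ^ (q * (k ∸ 4)) ≤ (16 * k) ^ (2 * (n + (k ∸ 4)))

{-# OPTIONS --safe #-}
-- Let bias_S(x) be the number of ones minus the number of zeros of x on S: MAJ_S(x) holds iff bias_S(x) ≥ 0, and
-- bias is additive over disjoint sets. Write k = 4 + d and read the input in β = ⌊n/L⌋ + 1 blocks of L ≈ d/2
-- indices, one query per block. The algorithm keeps a stack of disjoint pieces of the blocks read so far, all with
-- the same majority value, whose biases add up to the bias of everything read. A block agreeing with the stack is
-- pushed; otherwise it is merged with the top piece. To merge a piece P with majority and a piece N without, query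
-- P ∪ N (at most 2L ≤ k elements); adding the elements of one piece to the other one at a time moves the bias across
-- 0 in steps of at most 1, so a binary search with e ≈ log₂ L queries finds a prefix that, together with the other
-- piece, is exactly balanced. Discarding it leaves a single piece of bias bias(P) + bias(N), whose majority value is
-- the answer for P ∪ N, and merging goes on down the stack. Every merge pops a piece, so charging e + 1 queries to
-- each push bounds the total by β(e + 2); at the end the common value of the stack is the sign of the total bias.
-- Finally β d ≤ 2(n + d) and 2^(e + 2) ≤ 16k give the stated bound.

module Submission where

open import Defs
open import Data.Bool using (Bool; true; false; not; _xor_; if_then_else_)
open import Data.Nat as ℕ using (ℕ; zero; suc; _+_; _*_; _∸_; _^_; _≤_; _<_; z≤n; s≤s; _/_; NonZero)
import Data.Nat.Properties as ℕ
open import Data.Nat.DivMod using (m≡m%n+[m/n]*n; m%n<n; m/n*n≤m)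
open import Data.Integer as ℤ using (ℤ; 0ℤ; 1ℤ; -1ℤ; _⊖_)
import Data.Integer.Properties as ℤ
import Data.Integer.Tactic.RingSolver as ℤ
import Data.Nat.Tactic.RingSolver as ℕ
open import Data.Vec using (Vec; []; _∷_)
open import Data.List using (List; []; _∷_; length)
open import Data.List.Relation.Unary.All as All using (All; []; _∷_)
open import Data.List.Relation.Unary.AllPairs using (AllPairs; []; _∷_)
open import Data.Fin.Subset using (Subset; ∣_∣; ⊤; ⊥; _∪_)
open import Data.Fin.Subset.Properties using (∣⊥∣≡0; ∣⊤∣≡n; ∣p∣≤∣x∷p∣; ∪-identityʳ; ∪-comm)
open import Data.Product using (_×_; _,_; proj₁; proj₂; Σ; ∃-syntax)
open import Relation.Binary.PropositionalEquality
open import Relation.Nullary using (yes; no)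
open import Relation.Nullary.Reflects using (Reflects; ofʸ; ofⁿ; fromEquivalence; invert; det)
open import Relation.Nullary.Negation using (contradiction)

private variable
  m : ℕ
  t : ℕ
  p q : Subset m
  x : Vec Bool m
  i j : ℤ

-- Disjointness and prefixes of subsets

data Disjoint : Subset m → Subset m → Set where
  []    : Disjoint {zero} [] []
  skip  : Disjoint p q → Disjoint (false ∷ p) (false ∷ q)
  inˡ   : Disjoint p q → Disjoint (true ∷ p) (false ∷ q)
  inʳ   : Disjoint p q → Disjoint (false ∷ p) (true ∷ q)

Disjoint-sym : Disjoint p q → Disjoint q p
Disjoint-sym []       = []
Disjoint-sym (skip d) = skip (Disjoint-sym d)
Disjoint-sym (inˡ d)  = inʳ (Disjoint-sym d)
Disjoint-sym (inʳ d)  = inˡ (Disjoint-sym d)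

-- take t p keeps the first t elements of p (in index order, not the first t positions), drop t p the others.
take : ℕ → Subset m → Subset m
take zero    p           = ⊥
take (suc t) []          = []
take (suc t) (false ∷ p) = false ∷ take (suc t) p
take (suc t) (true ∷ p)  = true ∷ take t p

drop : ℕ → Subset m → Subset m
drop zero    p           = p
drop (suc t) []          = []
drop (suc t) (false ∷ p) = false ∷ drop (suc t) p
drop (suc t) (true ∷ p)  = false ∷ drop t p

Disjoint-⊥ˡ : Disjoint ⊥ p
Disjoint-⊥ˡ {p = []}        = []
Disjoint-⊥ˡ {p = false ∷ p} = skip Disjoint-⊥ˡ
Disjoint-⊥ˡ {p = true ∷ p}  = inʳ Disjoint-⊥ˡ

Disjoint-takeʳ : ∀ t → Disjoint q p → Disjoint q (take t p)
Disjoint-takeʳ zero    d        = Disjoint-sym Disjoint-⊥ˡ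
Disjoint-takeʳ (suc t) []       = []
Disjoint-takeʳ (suc t) (skip d) = skip (Disjoint-takeʳ (suc t) d)
Disjoint-takeʳ (suc t) (inˡ d)  = inˡ (Disjoint-takeʳ (suc t) d)
Disjoint-takeʳ (suc t) (inʳ d)  = inʳ (Disjoint-takeʳ t d)

Disjoint-dropʳ : ∀ t → Disjoint q p → Disjoint q (drop t p)
Disjoint-dropʳ zero    d        = d
Disjoint-dropʳ (suc t) []       = []
Disjoint-dropʳ (suc t) (skip d) = skip (Disjoint-dropʳ (suc t) d)
Disjoint-dropʳ (suc t) (inˡ d)  = inˡ (Disjoint-dropʳ (suc t) d)
Disjoint-dropʳ (suc t) (inʳ d)  = skip (Disjoint-dropʳ t d)

take-drop-disjoint : ∀ t (p : Subset m) → Disjoint (take t p) (drop t p)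
take-drop-disjoint zero    p           = Disjoint-⊥ˡ
take-drop-disjoint (suc t) []          = []
take-drop-disjoint (suc t) (false ∷ p) = skip (take-drop-disjoint (suc t) p)
take-drop-disjoint (suc t) (true ∷ p)  = inˡ (take-drop-disjoint t p)

Disjoint-takeˡ : ∀ t → Disjoint p q → Disjoint (take t p) q
Disjoint-takeˡ t d = Disjoint-sym (Disjoint-takeʳ t (Disjoint-sym d))

Disjoint-dropˡ : ∀ t → Disjoint p q → Disjoint (drop t p) q
Disjoint-dropˡ t d = Disjoint-sym (Disjoint-dropʳ t (Disjoint-sym d))

∣take∣≤∣p∣ : ∀ {m} t (p : Subset m) → ∣ take t p ∣ ≤ ∣ p ∣
∣take∣≤∣p∣ {m} zero    p           = ℕ.≤-trans (ℕ.≤-reflexive (∣⊥∣≡0 m)) z≤n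
∣take∣≤∣p∣     (suc t) []          = z≤n
∣take∣≤∣p∣     (suc t) (false ∷ p) = ∣take∣≤∣p∣ (suc t) p
∣take∣≤∣p∣     (suc t) (true ∷ p)  = s≤s (∣take∣≤∣p∣ t p)

∣take∣≤t : ∀ {m} t (p : Subset m) → ∣ take t p ∣ ≤ t
∣take∣≤t {m} zero    p           = ℕ.≤-reflexive (∣⊥∣≡0 m)
∣take∣≤t     (suc t) []          = z≤n
∣take∣≤t     (suc t) (false ∷ p) = ∣take∣≤t (suc t) p
∣take∣≤t     (suc t) (true ∷ p)  = s≤s (∣take∣≤t t p)

∣drop∣≡∣p∣∸t : ∀ t (p : Subset m) → ∣ drop t p ∣ ≡ ∣ p ∣ ∸ t
∣drop∣≡∣p∣∸t zero    p           = refl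
∣drop∣≡∣p∣∸t (suc t) []          = refl
∣drop∣≡∣p∣∸t (suc t) (false ∷ p) = ∣drop∣≡∣p∣∸t (suc t) p
∣drop∣≡∣p∣∸t (suc t) (true ∷ p)  = ∣drop∣≡∣p∣∸t t p

∣drop∣≤∣p∣ : ∀ t (p : Subset m) → ∣ drop t p ∣ ≤ ∣ p ∣
∣drop∣≤∣p∣ t p = ℕ.≤-trans (ℕ.≤-reflexive (∣drop∣≡∣p∣∸t t p)) (ℕ.m∸n≤m ∣ p ∣ t)

take-all : ∀ t (p : Subset m) → ∣ p ∣ ≤ t → take t p ≡ p
take-all zero    []          _       = refl
take-all zero    (false ∷ p) h       = cong (false ∷_) (take-all zero p h)
take-all (suc t) []          _       = refl
take-all (suc t) (false ∷ p) h       = cong (false ∷_) (take-all (suc t) p h)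
take-all (suc t) (true ∷ p)  (s≤s h) = cong (true ∷_) (take-all t p h)

∣p∪q∣≤∣p∣+∣q∣ : (p q : Subset m) → ∣ p ∪ q ∣ ≤ ∣ p ∣ + ∣ q ∣
∣p∪q∣≤∣p∣+∣q∣ []          []          = z≤n
∣p∪q∣≤∣p∣+∣q∣ (false ∷ p) (false ∷ q) = ∣p∪q∣≤∣p∣+∣q∣ p q
∣p∪q∣≤∣p∣+∣q∣ (false ∷ p) (true ∷ q)  =
  ℕ.≤-trans (s≤s (∣p∪q∣≤∣p∣+∣q∣ p q)) (ℕ.≤-reflexive (sym (ℕ.+-suc ∣ p ∣ ∣ q ∣)))
∣p∪q∣≤∣p∣+∣q∣ (true ∷ p)  (b ∷ q)     =
  s≤s (ℕ.≤-trans (∣p∪q∣≤∣p∣+∣q∣ p q) (ℕ.+-monoʳ-≤ ∣ p ∣ (∣p∣≤∣x∷p∣ b q)))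

-- The bias of x on a subset

bias : Subset m → Vec Bool m → ℤ
bias []          []          = 0ℤ
bias (false ∷ p) (_ ∷ x)     = bias p x
bias (true ∷ p)  (true ∷ x)  = ℤ.suc (bias p x)
bias (true ∷ p)  (false ∷ x) = ℤ.pred (bias p x)

bias≡2*sum⊖size : (p : Subset m) (x : Vec Bool m) → bias p x ≡ 2 * sumS p x ⊖ ∣ p ∣
bias≡2*sum⊖size []          []          = refl
bias≡2*sum⊖size (false ∷ p) (_ ∷ x)     = bias≡2*sum⊖size p x
bias≡2*sum⊖size (true ∷ p)  (true ∷ x)  = begin
  ℤ.suc (bias p x)                   ≡⟨ cong ℤ.suc (bias≡2*sum⊖size p x) ⟩
  1ℤ ℤ.+ (2 * s ⊖ ∣ p ∣)             ≡⟨ ℤ.distribʳ-⊖-+-pos 1 (2 * s) ∣ p ∣ ⟩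
  suc (2 * s) ⊖ ∣ p ∣                ≡⟨ cong (_⊖ ∣ p ∣) (sym (ℕ.+-suc s (s + 0))) ⟩
  (s + suc (s + 0)) ⊖ ∣ p ∣          ≡⟨ ℤ.[1+m]⊖[1+n]≡m⊖n (s + suc (s + 0)) ∣ p ∣ ⟨
  2 * suc s ⊖ suc ∣ p ∣              ∎
  where open ≡-Reasoning; s = sumS p x
bias≡2*sum⊖size (true ∷ p)  (false ∷ x) = begin
  ℤ.pred (bias p x)                  ≡⟨ cong ℤ.pred (bias≡2*sum⊖size p x) ⟩
  -1ℤ ℤ.+ (2 * sumS p x ⊖ ∣ p ∣)     ≡⟨ ℤ.distribʳ-⊖-+-neg 0 (2 * sumS p x) ∣ p ∣ ⟩
  2 * sumS p x ⊖ suc ∣ p ∣           ∎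
  where open ≡-Reasoning

MAJS-reflects : (p : Subset m) (x : Vec Bool m) → Reflects (0ℤ ℤ.≤ bias p x) (MAJS p x)
MAJS-reflects p x = fromEquivalence
  (λ maj → subst (0ℤ ℤ.≤_) (sym bias≡) (nonneg (ℕ.≤ᵇ⇒≤ ∣ p ∣ (2 * s) maj)))
  (λ 0≤bias → ℕ.≤⇒≤ᵇ (ℕ.≮⇒≥ λ 2s<∣p∣ → ℤ.<⇒≱ (neg 2s<∣p∣) (subst (0ℤ ℤ.≤_) bias≡ 0≤bias)))
  where
  s = sumS p x
  bias≡ = bias≡2*sum⊖size p x
  nonneg : ∣ p ∣ ≤ 2 * s → 0ℤ ℤ.≤ 2 * s ⊖ ∣ p ∣
  nonneg h = subst (ℤ._≤ 2 * s ⊖ ∣ p ∣) (ℤ.n⊖n≡0 (2 * s)) (ℤ.⊖-monoʳ-≥-≤ (2 * s) h)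
  neg : 2 * s < ∣ p ∣ → 2 * s ⊖ ∣ p ∣ ℤ.< 0ℤ
  neg h = subst (2 * s ⊖ ∣ p ∣ ℤ.<_) (ℤ.n⊖n≡0 (2 * s)) (ℤ.⊖-monoʳ->-< (2 * s) h)

bias-⊥ : (x : Vec Bool m) → bias ⊥ x ≡ 0ℤ
bias-⊥ []      = refl
bias-⊥ (_ ∷ x) = bias-⊥ x

+-sucʳ : ∀ i j → i ℤ.+ ℤ.suc j ≡ ℤ.suc (i ℤ.+ j)
+-sucʳ i j = begin
  i ℤ.+ (1ℤ ℤ.+ j)   ≡⟨ ℤ.+-assoc i 1ℤ j ⟨
  (i ℤ.+ 1ℤ) ℤ.+ j   ≡⟨ cong (ℤ._+ j) (ℤ.+-comm i 1ℤ) ⟩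
  (1ℤ ℤ.+ i) ℤ.+ j   ≡⟨ ℤ.+-assoc 1ℤ i j ⟩
  1ℤ ℤ.+ (i ℤ.+ j)   ∎
  where open ≡-Reasoning

bias-∪ : Disjoint p q → (x : Vec Bool m) → bias (p ∪ q) x ≡ bias p x ℤ.+ bias q x
bias-∪ []       []                    = refl
bias-∪ (skip d) (_ ∷ x)               = bias-∪ d x
bias-∪ (inˡ {p = p} {q} d) (true ∷ x)  =
  trans (cong ℤ.suc (bias-∪ d x)) (sym (ℤ.+-assoc 1ℤ (bias p x) (bias q x)))
bias-∪ (inˡ {p = p} {q} d) (false ∷ x) = trans (cong ℤ.pred (bias-∪ d x)) (sym (ℤ.pred-+ (bias p x) (bias q x)))
bias-∪ (inʳ {p = p} {q} d) (true ∷ x)  = trans (cong ℤ.suc (bias-∪ d x)) (sym (+-sucʳ (bias p x) (bias q x)))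
bias-∪ (inʳ {p = p} {q} d) (false ∷ x) = trans (cong ℤ.pred (bias-∪ d x)) (sym (ℤ.+-pred (bias p x) (bias q x)))

bias-take+drop : ∀ t (p : Subset m) x → bias (take t p) x ℤ.+ bias (drop t p) x ≡ bias p x
bias-take+drop zero    p           x           = trans (cong (ℤ._+ bias p x) (bias-⊥ x)) (ℤ.+-identityˡ _)
bias-take+drop (suc t) []          []          = refl
bias-take+drop (suc t) (false ∷ p) (_ ∷ x)     = bias-take+drop (suc t) p x
bias-take+drop (suc t) (true ∷ p)  (true ∷ x)  =
  trans (ℤ.+-assoc 1ℤ (bias (take t p) x) (bias (drop t p) x)) (cong ℤ.suc (bias-take+drop t p x))
bias-take+drop (suc t) (true ∷ p)  (false ∷ x) =
  trans (ℤ.pred-+ (bias (take t p) x) (bias (drop t p) x)) (cong ℤ.pred (bias-take+drop t p x))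

data Adjacent : ℤ → ℤ → Set where
  stay : Adjacent i i
  up   : Adjacent i (ℤ.suc i)
  down : Adjacent i (ℤ.pred i)

Adjacent-+ˡ : ∀ k → Adjacent i j → Adjacent (k ℤ.+ i) (k ℤ.+ j)
Adjacent-+ˡ k stay           = stay
Adjacent-+ˡ k (up {i = i})   = subst (Adjacent (k ℤ.+ i)) (sym (+-sucʳ k i)) up
Adjacent-+ˡ k (down {i = i}) = subst (Adjacent (k ℤ.+ i)) (sym (ℤ.+-pred k i)) down

Adjacent-crossing-up : Adjacent i j → i ℤ.< 0ℤ → 0ℤ ℤ.≤ j → j ≡ 0ℤ
Adjacent-crossing-up stay i<0 0≤i = contradiction 0≤i (ℤ.<⇒≱ i<0)
Adjacent-crossing-up up   i<0 0≤j = ℤ.≤-antisym (ℤ.i<j⇒suc[i]≤j i<0) 0≤j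
Adjacent-crossing-up down i<0 0≤j = contradiction (ℤ.≤-trans 0≤j (ℤ.i≤j⇒pred[i]≤j ℤ.≤-refl)) (ℤ.<⇒≱ i<0)

Adjacent-crossing-down : Adjacent i j → 0ℤ ℤ.≤ i → j ℤ.< 0ℤ → i ≡ 0ℤ
Adjacent-crossing-down         stay 0≤i i<0 = contradiction 0≤i (ℤ.<⇒≱ i<0)
Adjacent-crossing-down {i = i} up   0≤i j<0 = contradiction (ℤ.≤-trans 0≤i (ℤ.i≤suc[i] i)) (ℤ.<⇒≱ j<0)
Adjacent-crossing-down {i = i} down 0≤i j<0 =
  ℤ.≤-antisym (subst (ℤ._≤ 0ℤ) (ℤ.suc-pred i) (ℤ.i<j⇒suc[i]≤j j<0)) 0≤i

bias-take-suc : ∀ t (p : Subset m) x → Adjacent (bias (take t p) x) (bias (take (suc t) p) x)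
bias-take-suc zero    []          []          = stay
bias-take-suc zero    (false ∷ p) (_ ∷ x)     = bias-take-suc zero p x
bias-take-suc zero    (true ∷ p)  (true ∷ x)  = up
bias-take-suc zero    (true ∷ p)  (false ∷ x) = down
bias-take-suc (suc t) []          []          = stay
bias-take-suc (suc t) (false ∷ p) (_ ∷ x)     = bias-take-suc (suc t) p x
bias-take-suc (suc t) (true ∷ p)  (true ∷ x)  = Adjacent-+ˡ 1ℤ (bias-take-suc t p x)
bias-take-suc (suc t) (true ∷ p)  (false ∷ x) = Adjacent-+ˡ -1ℤ (bias-take-suc t p x)

bias-∅ : (p : Subset m) (x : Vec Bool m) → ∣ p ∣ ≡ 0 → bias p x ≡ 0ℤ
bias-∅ []          []      _ = refl
bias-∅ (false ∷ p) (_ ∷ x) h = bias-∅ p x h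

MAJS≡true⇒0≤bias : ∀ (p : Subset m) x → MAJS p x ≡ true → 0ℤ ℤ.≤ bias p x
MAJS≡true⇒0≤bias p x eq = invert (subst (Reflects _) eq (MAJS-reflects p x))

MAJS≡false⇒bias<0 : ∀ (p : Subset m) x → MAJS p x ≡ false → bias p x ℤ.< 0ℤ
MAJS≡false⇒bias<0 p x eq = ℤ.≰⇒> (invert (subst (Reflects _) eq (MAJS-reflects p x)))

0≤bias⇒MAJS≡true : ∀ (p : Subset m) x → 0ℤ ℤ.≤ bias p x → MAJS p x ≡ true
0≤bias⇒MAJS≡true p x h = det (MAJS-reflects p x) (ofʸ h)

bias<0⇒MAJS≡false : ∀ (p : Subset m) x → bias p x ℤ.< 0ℤ → MAJS p x ≡ false
bias<0⇒MAJS≡false p x h = det (MAJS-reflects p x) (ofⁿ (ℤ.<⇒≱ h))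

bias-∪take-suc : Disjoint q p → ∀ t x → Adjacent (bias (q ∪ take t p) x) (bias (q ∪ take (suc t) p) x)
bias-∪take-suc {q = q} {p = p} d t x =
  subst₂ Adjacent (sym (bias-∪ (Disjoint-takeʳ t d) x)) (sym (bias-∪ (Disjoint-takeʳ (suc t) d) x))
         (Adjacent-+ˡ (bias q x) (bias-take-suc t p x))

flip-up⇒balanced : Disjoint q p → MAJS (q ∪ take t p) x ≡ false → MAJS (q ∪ take (suc t) p) x ≡ true →
                   bias (q ∪ take (suc t) p) x ≡ 0ℤ
flip-up⇒balanced {q = q} {p = p} {t = t} {x = x} d before after =
  Adjacent-crossing-up (bias-∪take-suc d t x)
    (MAJS≡false⇒bias<0 (q ∪ take t p) x before) (MAJS≡true⇒0≤bias (q ∪ take (suc t) p) x after)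

flip-down⇒balanced : Disjoint q p → MAJS (q ∪ take t p) x ≡ true → MAJS (q ∪ take (suc t) p) x ≡ false →
                     bias (q ∪ take t p) x ≡ 0ℤ
flip-down⇒balanced {q = q} {p = p} {t = t} {x = x} d before after =
  Adjacent-crossing-down (bias-∪take-suc d t x)
    (MAJS≡true⇒0≤bias (q ∪ take t p) x before) (MAJS≡false⇒bias<0 (q ∪ take (suc t) p) x after)

drop-balanced : Disjoint q p → ∀ t x → bias (q ∪ take t p) x ≡ 0ℤ → bias (drop t p) x ≡ bias p x ℤ.+ bias q x
drop-balanced {q = q} {p = p} d t x balanced = sym (begin
  bias p x ℤ.+ bias q x                      ≡⟨ cong (ℤ._+ bias q x) (bias-take+drop t p x) ⟨
  (bias (take t p) x ℤ.+ bias (drop t p) x) ℤ.+ bias q x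
    ≡⟨ rearrange (bias (take t p) x) (bias (drop t p) x) (bias q x) ⟩
  bias (drop t p) x ℤ.+ (bias q x ℤ.+ bias (take t p) x)
    ≡⟨ cong (ℤ._+_ (bias (drop t p) x)) (trans (sym (bias-∪ (Disjoint-takeʳ t d) x)) balanced) ⟩
  bias (drop t p) x ℤ.+ 0ℤ                   ≡⟨ ℤ.+-identityʳ _ ⟩
  bias (drop t p) x                          ∎)
  where
  open ≡-Reasoning
  rearrange : ∀ a b c → (a ℤ.+ b) ℤ.+ c ≡ b ℤ.+ (c ℤ.+ a)
  rearrange = ℤ.solve-∀

-- Adaptive query programs

+-2^suc : ∀ a j → a + 2 ^ suc j ≡ a + 2 ^ j + 2 ^ j
+-2^suc a j = trans (cong (a +_) (cong (2 ^ j +_) (ℕ.+-identityʳ (2 ^ j)))) (sym (ℕ.+-assoc a (2 ^ j) (2 ^ j)))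

data Prog (n k : ℕ) (A : Set) : Set where
  return : A → Prog n k A
  ask    : (S : Subset n) → ∣ S ∣ ≤ k → (Bool → Prog n k A) → Prog n k A

module _ {n k : ℕ} where

  private variable
    A B : Set

  _>>=_ : Prog n k A → (A → Prog n k B) → Prog n k B
  return a    >>= f = f a
  ask S h g   >>= f = ask S h (λ b → g b >>= f)

  _<$>_ : (A → B) → Prog n k A → Prog n k B
  f <$> P = P >>= λ a → return (f a)

  eval : Prog n k A → Vec Bool n → A
  eval (return a)  x = a
  eval (ask S _ g) x = eval (g (MAJS S x)) x

  cost : Prog n k A → Vec Bool n → ℕ
  cost (return a)  x = 0
  cost (ask S _ g) x = suc (cost (g (MAJS S x)) x)

  eval->>= : (P : Prog n k A) (f : A → Prog n k B) (x : Vec Bool n) → eval (P >>= f) x ≡ eval (f (eval P x)) x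
  eval->>= (return a)  f x = refl
  eval->>= (ask S _ g) f x = eval->>= (g (MAJS S x)) f x

  cost->>= : (P : Prog n k A) (f : A → Prog n k B) (x : Vec Bool n) →
             cost (P >>= f) x ≡ cost P x + cost (f (eval P x)) x
  cost->>= (return a)  f x = refl
  cost->>= (ask S _ g) f x = cong suc (cost->>= (g (MAJS S x)) f x)

  eval-<$> : (f : A → B) (P : Prog n k A) (x : Vec Bool n) → eval (f <$> P) x ≡ f (eval P x)
  eval-<$> f P = eval->>= P (λ a → return (f a))

  cost-<$> : (f : A → B) (P : Prog n k A) (x : Vec Bool n) → cost (f <$> P) x ≡ cost P x
  cost-<$> f P x = trans (cost->>= P (λ a → return (f a)) x) (ℕ.+-identityʳ (cost P x))

  toAlgorithm : Prog n k Bool → Algorithm n k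
  toAlgorithm (return b)  = output b
  toAlgorithm (ask S h g) = query S h (toAlgorithm (g false)) (toAlgorithm (g true))

  run-toAlgorithm : (P : Prog n k Bool) (x : Vec Bool n) → run (toAlgorithm P) x ≡ eval P x
  run-toAlgorithm (return b)  x = refl
  run-toAlgorithm (ask S _ g) x with MAJS S x
  ... | false = run-toAlgorithm (g false) x
  ... | true  = run-toAlgorithm (g true) x

  queries-toAlgorithm : (P : Prog n k Bool) (x : Vec Bool n) → queries (toAlgorithm P) x ≡ cost P x
  queries-toAlgorithm (return b)  x = refl
  queries-toAlgorithm (ask S _ g) x with MAJS S x
  ... | false = cong suc (queries-toAlgorithm (g false) x)
  ... | true  = cong suc (queries-toAlgorithm (g true) x)

  search : (Q : ℕ → Subset n) → (∀ t → ∣ Q t ∣ ≤ k) → Bool → ℕ → ℕ → Prog n k ℕ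
  search Q small b zero    lo = return lo
  search Q small b (suc j) lo = ask (Q mid) (small mid) λ a → search Q small b j (if a xor b then lo else mid)
    where mid = lo + 2 ^ j

  search-cost : ∀ Q small b j lo (x : Vec Bool n) → cost (search Q small b j lo) x ≡ j
  search-cost Q small b zero    lo x = refl
  search-cost Q small b (suc j) lo x = cong suc (search-cost Q small b j _ x)

  search-flip : ∀ Q small b j lo (x : Vec Bool n) →
                MAJS (Q lo) x ≡ b → MAJS (Q (lo + 2 ^ j)) x ≡ not b →
                let t = eval (search Q small b j lo) x in
                MAJS (Q t) x ≡ b × MAJS (Q (suc t)) x ≡ not b
  search-flip Q small b zero    lo x lo≡b hi≡¬b = lo≡b , subst (λ t → MAJS (Q t) x ≡ not b) (ℕ.+-comm lo 1) hi≡¬b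
  search-flip Q small b (suc j) lo x lo≡b hi≡¬b with MAJS (Q (lo + 2 ^ j)) x in mid≡
  search-flip Q small true  (suc j) lo x lo≡b hi≡¬b | true  =
    search-flip Q small true j _ x mid≡ (subst (λ t → MAJS (Q t) x ≡ false) (+-2^suc lo j) hi≡¬b)
  search-flip Q small true  (suc j) lo x lo≡b hi≡¬b | false = search-flip Q small true  j lo x lo≡b mid≡
  search-flip Q small false (suc j) lo x lo≡b hi≡¬b | true  = search-flip Q small false j lo x lo≡b mid≡
  search-flip Q small false (suc j) lo x lo≡b hi≡¬b | false =
    search-flip Q small false j _ x mid≡ (subst (λ t → MAJS (Q t) x ≡ true) (+-2^suc lo j) hi≡¬b)

-- The merging algorithm

module Majority (n k L e : ℕ) (2L≤k : L + L ≤ k) (L≤2^e : L ≤ 2 ^ e) where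

  record Piece : Set where
    constructor piece
    field
      elements : Subset n
      small    : ∣ elements ∣ ≤ L
  open Piece

  dropPiece : ℕ → Piece → Piece
  dropPiece t P = piece (drop t (elements P)) (ℕ.≤-trans (∣drop∣≤∣p∣ t (elements P)) (small P))

  ∪-small : (p q : Subset n) → ∣ p ∣ ≤ L → ∣ q ∣ ≤ L → ∣ p ∪ q ∣ ≤ k
  ∪-small p q ∣p∣≤L ∣q∣≤L = ℕ.≤-trans (∣p∪q∣≤∣p∣+∣q∣ p q) (ℕ.≤-trans (ℕ.+-mono-≤ ∣p∣≤L ∣q∣≤L) 2L≤k)

  prefixes : Piece → Piece → ℕ → Subset n
  prefixes Q P t = elements Q ∪ take t (elements P)

  prefixes-small : ∀ Q P t → ∣ prefixes Q P t ∣ ≤ k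
  prefixes-small Q P t =
    ∪-small (elements Q) (take t (elements P)) (small Q) (ℕ.≤-trans (∣take∣≤∣p∣ t (elements P)) (small P))

  prefixes-none : ∀ Q P → prefixes Q P 0 ≡ elements Q
  prefixes-none Q P = ∪-identityʳ (elements Q)

  prefixes-all : ∀ Q P → prefixes Q P (2 ^ e) ≡ elements Q ∪ elements P
  prefixes-all Q P = cong (elements Q ∪_) (take-all (2 ^ e) (elements P) (ℕ.≤-trans (small P) L≤2^e))

  -- The flip is searched in prefixes of P if P ∪ N has majority, in prefixes of N otherwise; the balanced
  -- prefix is the one just after the flip in the first case and just before it in the second.
  merge : Piece → Piece → Prog n k (Piece × Bool)
  merge P N = ask (elements P ∪ elements N) (∪-small (elements P) (elements N) (small P) (small N)) λ where
    true  → (λ t → dropPiece (suc t) P , true) <$> search (prefixes N P) (prefixes-small N P) false e 0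
    false → (λ t → dropPiece t N , false)      <$> search (prefixes P N) (prefixes-small P N) true  e 0

  merge-cost : ∀ P N x → cost (merge P N) x ≡ suc e
  merge-cost P N x with MAJS (elements P ∪ elements N) x
  ... | true  = cong suc (trans (cost-<$> _ (search (prefixes N P) _ false e 0) x) (search-cost _ _ false e 0 x))
  ... | false = cong suc (trans (cost-<$> _ (search (prefixes P N) _ true  e 0) x) (search-cost _ _ true  e 0 x))

  record Merged (x : Vec Bool n) (P N : Piece) (r : Piece × Bool) : Set where
    field
      value    : MAJS (elements (proj₁ r)) x ≡ proj₂ r
      bias≡    : bias (elements (proj₁ r)) x ≡ bias (elements P) x ℤ.+ bias (elements N) x
      disjoint : ∀ {D} → Disjoint D (elements P) → Disjoint D (elements N) → Disjoint D (elements (proj₁ r))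

  merged-up : ∀ {P N} x t → Disjoint (elements P) (elements N) → MAJS (elements P ∪ elements N) x ≡ true →
              MAJS (prefixes N P t) x ≡ false → MAJS (prefixes N P (suc t)) x ≡ true →
              Merged x P N (dropPiece (suc t) P , true)
  merged-up {P} {N} x t d P∪N≡true before after = record
    { value    = 0≤bias⇒MAJS≡true (drop (suc t) (elements P)) x
                   (subst (0ℤ ℤ.≤_) (trans (bias-∪ d x) (sym bias≡))
                          (MAJS≡true⇒0≤bias (elements P ∪ elements N) x P∪N≡true))
    ; bias≡    = bias≡
    ; disjoint = λ dP _ → Disjoint-dropʳ (suc t) dP
    }
    where
    bias≡ = drop-balanced (Disjoint-sym d) (suc t) x (flip-up⇒balanced (Disjoint-sym d) before after)

  merged-down : ∀ {P N} x t → Disjoint (elements P) (elements N) → MAJS (elements P ∪ elements N) x ≡ false →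
                MAJS (prefixes P N t) x ≡ true → MAJS (prefixes P N (suc t)) x ≡ false →
                Merged x P N (dropPiece t N , false)
  merged-down {P} {N} x t d P∪N≡false before after = record
    { value    = bias<0⇒MAJS≡false (drop t (elements N)) x
                   (subst (ℤ._< 0ℤ) (trans (bias-∪ d x) (sym bias≡))
                          (MAJS≡false⇒bias<0 (elements P ∪ elements N) x P∪N≡false))
    ; bias≡    = bias≡
    ; disjoint = λ _ dN → Disjoint-dropʳ t dN
    }
    where
    bias≡ = trans (drop-balanced d t x (flip-down⇒balanced d before after))
                  (ℤ.+-comm (bias (elements N) x) (bias (elements P) x))

  merge-spec : ∀ P N x → Disjoint (elements P) (elements N) →
               MAJS (elements P) x ≡ true → MAJS (elements N) x ≡ false → Merged x P N (eval (merge P N) x)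
  merge-spec P N x d P≡true N≡false with MAJS (elements P ∪ elements N) x in P∪N≡
  ... | true  = subst (Merged x P N) (sym (eval-<$> _ (search (prefixes N P) _ false e 0) x))
                  (merged-up x _ d P∪N≡ (proj₁ flip) (proj₂ flip))
    where
    flip = search-flip (prefixes N P) (prefixes-small N P) false e 0 x
             (trans (cong (λ S → MAJS S x) (prefixes-none N P)) N≡false)
             (trans (cong (λ S → MAJS S x) (trans (prefixes-all N P) (∪-comm _ _))) P∪N≡)
  ... | false = subst (Merged x P N) (sym (eval-<$> _ (search (prefixes P N) _ true e 0) x))
                  (merged-down x _ d P∪N≡ (proj₁ flip) (proj₂ flip))
    where
    flip = search-flip (prefixes P N) (prefixes-small P N) true e 0 x
             (trans (cong (λ S → MAJS S x) (prefixes-none P N)) P≡true)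
             (trans (cong (λ S → MAJS S x) (prefixes-all P N)) P∪N≡)

  Merged-sym : ∀ {x P N r} → Merged x P N r → Merged x N P r
  Merged-sym {x} {P} {N} merged = record
    { value    = value
    ; bias≡    = trans bias≡ (ℤ.+-comm (bias (elements P) x) (bias (elements N) x))
    ; disjoint = λ dN dP → disjoint dP dN
    }
    where open Merged merged

  Stack : Set
  Stack = Bool × List Piece

  Agree : Vec Bool n → Bool → List Piece → Set
  Agree x c = All (λ P → MAJS (elements P) x ≡ c)

  DisjointFrom : Subset n → List Piece → Set
  DisjointFrom D = All (λ P → Disjoint D (elements P))

  Pairwise : List Piece → Set
  Pairwise = AllPairs (λ P Q → Disjoint (elements P) (elements Q))

  biasSum : List Piece → Vec Bool n → ℤ
  biasSum []       x = 0ℤ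
  biasSum (P ∷ ps) x = bias (elements P) x ℤ.+ biasSum ps x

  insert : Piece → Bool → Stack → Prog n k Stack
  insert P true  (true  , ps)     = return (true  , P ∷ ps)
  insert P false (false , ps)     = return (false , P ∷ ps)
  insert P c     (_     , [])     = return (c     , P ∷ [])
  insert P true  (false , Q ∷ ps) = merge P Q >>= λ r → insert (proj₁ r) (proj₂ r) (false , ps)
  insert P false (true  , Q ∷ ps) = merge Q P >>= λ r → insert (proj₁ r) (proj₂ r) (true  , ps)

  record Inserted (x : Vec Bool n) (P : Piece) (ps : List Piece) (s : Stack) : Set where
    field
      pairwise : Pairwise (proj₂ s)
      agree    : Agree x (proj₁ s) (proj₂ s)
      disjoint : ∀ {D} → Disjoint D (elements P) → DisjointFrom D ps → DisjointFrom D (proj₂ s)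
      biasSum≡ : biasSum (proj₂ s) x ≡ bias (elements P) x ℤ.+ biasSum ps x

  pushed : ∀ {x P c ps} → Pairwise ps → DisjointFrom (elements P) ps → MAJS (elements P) x ≡ c → Agree x c ps →
           Inserted x P ps (c , P ∷ ps)
  pushed pw dP Pc ag = record { pairwise = dP ∷ pw ; agree = Pc ∷ ag ; disjoint = _∷_ ; biasSum≡ = refl }

  merged-then-inserted : ∀ {x P Q ps r s} → Merged x P Q r → Inserted x (proj₁ r) ps s → Inserted x P (Q ∷ ps) s
  merged-then-inserted {x} {P} {Q} {ps} merged i = record
    { pairwise = Inserted.pairwise i
    ; agree    = Inserted.agree i
    ; disjoint = λ { dP (dQ ∷ dps) → Inserted.disjoint i (Merged.disjoint merged dP dQ) dps }
    ; biasSum≡ = trans (Inserted.biasSum≡ i)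
                   (trans (cong (ℤ._+ biasSum ps x) (Merged.bias≡ merged))
                          (ℤ.+-assoc (bias (elements P) x) (bias (elements Q) x) (biasSum ps x)))
    }

  Merged-disjointFrom : ∀ {x P Q r ps} → Merged x P Q r →
                        DisjointFrom (elements P) ps → DisjointFrom (elements Q) ps → DisjointFrom (elements (proj₁ r)) ps
  Merged-disjointFrom merged dP dQ =
    All.zipWith (λ (dPS , dQS) → Disjoint-sym (Merged.disjoint merged (Disjoint-sym dPS) (Disjoint-sym dQS))) (dP , dQ)

  insert-spec : ∀ x P c s → Pairwise (proj₂ s) → DisjointFrom (elements P) (proj₂ s) →
                MAJS (elements P) x ≡ c → Agree x (proj₁ s) (proj₂ s) → Inserted x P (proj₂ s) (eval (insert P c s) x)
  insert-spec x P true  (true  , ps)     pw dP Pc ag = pushed pw dP Pc ag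
  insert-spec x P false (false , ps)     pw dP Pc ag = pushed pw dP Pc ag
  insert-spec x P true  (false , [])     pw dP Pc ag = pushed pw dP Pc []
  insert-spec x P false (true  , [])     pw dP Pc ag = pushed pw dP Pc []
  insert-spec x P true  (false , Q ∷ ps) (dQ ∷ pw) (dPQ ∷ dP) Pc (Qc ∷ ag) =
    subst (Inserted x P (Q ∷ ps)) (sym (eval->>= (merge P Q) _ x))
      (merged-then-inserted merged
        (insert-spec x _ _ (false , ps) pw (Merged-disjointFrom merged dP dQ) (Merged.value merged) ag))
    where merged = merge-spec P Q x dPQ Pc Qc
  insert-spec x P false (true  , Q ∷ ps) (dQ ∷ pw) (dPQ ∷ dP) Pc (Qc ∷ ag) =
    subst (Inserted x P (Q ∷ ps)) (sym (eval->>= (merge Q P) _ x))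
      (merged-then-inserted merged
        (insert-spec x _ _ (true , ps) pw (Merged-disjointFrom merged dP dQ) (Merged.value merged) ag))
    where merged = Merged-sym (merge-spec Q P x (Disjoint-sym dPQ) Qc Pc)

  merge-then-cost : ∀ x (M : Prog n k (Piece × Bool)) (f : Piece × Bool → Prog n k Stack) l → cost M x ≡ suc e →
                    cost (f (eval M x)) x + suc e * length (proj₂ (eval (f (eval M x)) x)) ≤ suc e * suc l →
                    cost (M >>= f) x + suc e * length (proj₂ (eval (M >>= f) x)) ≤ suc e * suc (suc l)
  merge-then-cost x M f l cost≡ rest = begin
    cost (M >>= f) x + suc e * length (proj₂ (eval (M >>= f) x))
      ≡⟨ cong₂ _+_ (cost->>= M f x) (cong (λ s → suc e * length (proj₂ s)) (eval->>= M f x)) ⟩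
    cost M x + cost (f r) x + suc e * length (proj₂ (eval (f r) x))
      ≡⟨ ℕ.+-assoc (cost M x) _ _ ⟩
    cost M x + (cost (f r) x + suc e * length (proj₂ (eval (f r) x)))
      ≤⟨ ℕ.+-mono-≤ (ℕ.≤-reflexive cost≡) rest ⟩
    suc e + suc e * suc l
      ≡⟨ ℕ.*-suc (suc e) (suc l) ⟨
    suc e * suc (suc l) ∎
    where
    open ℕ.≤-Reasoning
    r = eval M x

  -- Each piece on the stack carries e + 1 queries of credit for the merge that will pop it.
  insert-cost : ∀ x P c s → cost (insert P c s) x + suc e * length (proj₂ (eval (insert P c s) x)) ≤
                            suc e * suc (length (proj₂ s))
  insert-cost x P true  (true  , ps)     = ℕ.≤-refl
  insert-cost x P false (false , ps)     = ℕ.≤-refl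
  insert-cost x P true  (false , [])     = ℕ.≤-refl
  insert-cost x P false (true  , [])     = ℕ.≤-refl
  insert-cost x P true  (false , Q ∷ ps) =
    merge-then-cost x (merge P Q) _ (length ps) (merge-cost P Q x)
      (insert-cost x (proj₁ (eval (merge P Q) x)) (proj₂ (eval (merge P Q) x)) (false , ps))
  insert-cost x P false (true  , Q ∷ ps) =
    merge-then-cost x (merge Q P) _ (length ps) (merge-cost Q P x)
      (insert-cost x (proj₁ (eval (merge Q P) x)) (proj₂ (eval (merge Q P) x)) (true , ps))

  biasSum-nonneg : ∀ {x ps} → Agree x true ps → 0ℤ ℤ.≤ biasSum ps x
  biasSum-nonneg []       = ℤ.≤-refl
  biasSum-nonneg {x} (_∷_ {P} P≡true ag) =
    ℤ.+-mono-≤ (MAJS≡true⇒0≤bias (elements P) x P≡true) (biasSum-nonneg ag)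

  biasSum-nonpos : ∀ {x ps} → Agree x false ps → biasSum ps x ℤ.≤ 0ℤ
  biasSum-nonpos []       = ℤ.≤-refl
  biasSum-nonpos {x} (_∷_ {P} P≡false ag) =
    ℤ.+-mono-≤ (ℤ.<⇒≤ (MAJS≡false⇒bias<0 (elements P) x P≡false)) (biasSum-nonpos ag)

  -- An empty stack means that everything read was balanced.
  verdict : Stack → Bool
  verdict (c , [])    = true
  verdict (c , _ ∷ _) = c

  verdict-correct : ∀ x c ps → Agree x c ps → bias ⊤ x ≡ biasSum ps x → verdict (c , ps) ≡ MAJ x
  verdict-correct x c     []       _  total =
    sym (0≤bias⇒MAJS≡true ⊤ x (subst (0ℤ ℤ.≤_) (sym total) ℤ.≤-refl))
  verdict-correct x true  (P ∷ ps) ag total =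
    sym (0≤bias⇒MAJS≡true ⊤ x (subst (0ℤ ℤ.≤_) (sym total) (biasSum-nonneg ag)))
  verdict-correct x false (P ∷ ps) (P≡false ∷ ag) total =
    sym (bias<0⇒MAJS≡false ⊤ x (subst (ℤ._< 0ℤ) (sym total)
      (ℤ.+-mono-<-≤ (MAJS≡false⇒bias<0 (elements P) x P≡false) (biasSum-nonpos ag))))

  block : Subset n → Piece
  block A = piece (take L A) (∣take∣≤t L A)

  process : ℕ → Subset n → Stack → Prog n k Bool
  process zero    A s = return (verdict s)
  process (suc f) A s = ask (take L A) (ℕ.≤-trans (∣take∣≤t L A) (ℕ.≤-trans (ℕ.m≤m+n L L) 2L≤k)) λ b →
                          insert (block A) b s >>= process f (drop L A)

  process-cost : ∀ f A s x → cost (process f A s) x ≤ f * (2 + e) + suc e * length (proj₂ s)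
  process-cost zero    A s x = z≤n
  process-cost (suc f) A s x = begin
    suc (cost (ins >>= process f (drop L A)) x)
      ≡⟨ cong suc (cost->>= ins (process f (drop L A)) x) ⟩
    suc (cost ins x + cost (process f (drop L A) s′) x)
      ≤⟨ s≤s (ℕ.+-monoʳ-≤ (cost ins x) (process-cost f (drop L A) s′ x)) ⟩
    suc (cost ins x + (f * (2 + e) + suc e * length (proj₂ s′)))
      ≡⟨ cong suc (swap (cost ins x) (f * (2 + e)) _) ⟩
    suc (f * (2 + e) + (cost ins x + suc e * length (proj₂ s′)))
      ≤⟨ s≤s (ℕ.+-monoʳ-≤ (f * (2 + e)) (insert-cost x (block A) (MAJS (take L A) x) s)) ⟩
    suc (f * (2 + e) + suc e * suc (length (proj₂ s)))
      ≡⟨ regroup f e (length (proj₂ s)) ⟩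
    suc f * (2 + e) + suc e * length (proj₂ s) ∎
    where
    open ℕ.≤-Reasoning
    ins = insert (block A) (MAJS (take L A) x) s
    s′ = eval ins x
    swap : ∀ a b c → a + (b + c) ≡ b + (a + c)
    swap = ℕ.solve-∀
    regroup : ∀ f e l → suc (f * (2 + e) + suc e * suc l) ≡ suc f * (2 + e) + suc e * l
    regroup = ℕ.solve-∀

  record Invariant (x : Vec Bool n) (A : Subset n) (s : Stack) : Set where
    field
      pairwise : Pairwise (proj₂ s)
      apart    : DisjointFrom A (proj₂ s)
      agree    : Agree x (proj₁ s) (proj₂ s)
      balance  : bias ⊤ x ≡ bias A x ℤ.+ biasSum (proj₂ s) x

  Invariant-step : ∀ {x A s} → Invariant x A s →
                   Invariant x (drop L A) (eval (insert (block A) (MAJS (take L A) x) s) x)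
  Invariant-step {x} {A} {s} inv = record
    { pairwise = Inserted.pairwise inserted
    ; apart    = Inserted.disjoint inserted (Disjoint-sym (take-drop-disjoint L A)) (All.map (Disjoint-dropˡ L) apart)
    ; agree    = Inserted.agree inserted
    ; balance  = begin
        bias ⊤ x                                  ≡⟨ balance ⟩
        bias A x ℤ.+ rest                         ≡⟨ cong (ℤ._+ rest) (bias-take+drop L A x) ⟨
        (bias (take L A) x ℤ.+ bias (drop L A) x) ℤ.+ rest
          ≡⟨ swap (bias (take L A) x) (bias (drop L A) x) rest ⟩
        bias (drop L A) x ℤ.+ (bias (take L A) x ℤ.+ rest)
          ≡⟨ cong (ℤ._+_ (bias (drop L A) x)) (Inserted.biasSum≡ inserted) ⟨
        bias (drop L A) x ℤ.+ biasSum (proj₂ (eval (insert (block A) (MAJS (take L A) x) s) x)) x ∎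
    }
    where
    open ≡-Reasoning
    open Invariant inv
    rest = biasSum (proj₂ s) x
    inserted = insert-spec x (block A) _ s pairwise (All.map (Disjoint-takeˡ L) apart) refl agree
    swap : ∀ a b c → (a ℤ.+ b) ℤ.+ c ≡ b ℤ.+ (a ℤ.+ c)
    swap = ℤ.solve-∀

  process-correct : ∀ f A s x → ∣ A ∣ ≤ f * L → Invariant x A s → eval (process f A s) x ≡ MAJ x
  process-correct zero    A (c , ps) x ∣A∣≤0 inv = verdict-correct x c ps agree total
    where
    open Invariant inv
    total : bias ⊤ x ≡ biasSum ps x
    total = trans balance (trans (cong (ℤ._+ biasSum ps x) (bias-∅ A x (ℕ.n≤0⇒n≡0 ∣A∣≤0))) (ℤ.+-identityˡ (biasSum ps x)))
  process-correct (suc f) A s x ∣A∣≤ inv =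
    trans (eval->>= (insert (block A) (MAJS (take L A) x) s) (process f (drop L A)) x)
          (process-correct f (drop L A) _ x ∣drop∣≤ (Invariant-step inv))
    where
    ∣drop∣≤ : ∣ drop L A ∣ ≤ f * L
    ∣drop∣≤ = subst (_≤ f * L) (sym (∣drop∣≡∣p∣∸t L A)) (ℕ.m≤n+o⇒m∸n≤o ∣ A ∣ L ∣A∣≤)

  majority : ℕ → Algorithm n k
  majority β = toAlgorithm (process β ⊤ (true , []))

  majority-correct : ∀ β x → n ≤ β * L → run (majority β) x ≡ MAJ x
  majority-correct β x n≤βL = trans (run-toAlgorithm (process β ⊤ (true , [])) x)
    (process-correct β ⊤ (true , []) x (subst (_≤ β * L) (sym (∣⊤∣≡n n)) n≤βL) initial)
    where
    initial : Invariant x ⊤ (true , [])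
    initial = record { pairwise = [] ; apart = [] ; agree = [] ; balance = sym (ℤ.+-identityʳ (bias ⊤ x)) }

  majority-queries : ∀ β x → queries (majority β) x ≤ β * (2 + e)
  majority-queries β x = begin
    queries (majority β) x                 ≡⟨ queries-toAlgorithm (process β ⊤ (true , [])) x ⟩
    cost (process β ⊤ (true , [])) x       ≤⟨ process-cost β ⊤ (true , []) x ⟩
    β * (2 + e) + suc e * 0                ≡⟨ cong (β * (2 + e) +_) (ℕ.*-zeroʳ (suc e)) ⟩
    β * (2 + e) + 0                        ≡⟨ ℕ.+-identityʳ (β * (2 + e)) ⟩
    β * (2 + e)                            ∎
    where open ℕ.≤-Reasoning

-- Choice of parameters

halve : ∀ d → ∃[ h ] d ≤ h + h × h + h ≤ suc d
halve zero          = 0 , z≤n , z≤n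
halve (suc zero)    = 1 , s≤s z≤n , ℕ.≤-refl
halve (suc (suc d)) with halve d
... | h , lower , upper = suc h , subst (suc (suc d) ≤_) (sym 2+h+h) (s≤s (s≤s lower))
                                 , subst (_≤ suc (suc (suc d))) (sym 2+h+h) (s≤s (s≤s upper))
  where
  2+h+h : suc h + suc h ≡ suc (suc (h + h))
  2+h+h = cong suc (ℕ.+-suc h h)

2^-between : ∀ m → ∃[ e ] m ≤ 2 ^ e × 2 ^ e ≤ suc (m + m)
2^-between zero = 0 , z≤n , ℕ.≤-refl
2^-between (suc m) with 2^-between m
... | e , m≤2^e , 2^e≤1+2m with suc m ℕ.≤? 2 ^ e
...   | yes 1+m≤2^e = e , 1+m≤2^e , ℕ.≤-trans 2^e≤1+2m (s≤s (ℕ.+-mono-≤ (ℕ.n≤1+n m) (ℕ.n≤1+n m)))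
...   | no  1+m≰2^e = suc e , subst (suc m ≤_) (sym 2^[1+e]≡m+m) 1+m≤m+m
                            , subst (_≤ suc (suc m + suc m)) (sym 2^[1+e]≡m+m)
                                    (ℕ.m≤n⇒m≤1+n (ℕ.+-mono-≤ (ℕ.n≤1+n m) (ℕ.n≤1+n m)))
  where
  2^e≡m : 2 ^ e ≡ m
  2^e≡m = ℕ.≤-antisym (ℕ.≤-pred (ℕ.≰⇒> 1+m≰2^e)) m≤2^e
  2^[1+e]≡m+m : 2 ^ suc e ≡ m + m
  2^[1+e]≡m+m = trans (cong (λ a → a + (a + 0)) 2^e≡m) (cong (m +_) (ℕ.+-identityʳ m))
  1+m≤m+m : suc m ≤ m + m
  1+m≤m+m = subst (_≤ m + m) (ℕ.+-comm m 1) (ℕ.+-monoʳ-≤ m (subst (1 ≤_) 2^e≡m (ℕ.m^n>0 2 e)))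

blockCount : ∀ n L .{{_ : NonZero L}} → n ≤ suc (n / L) * L × suc (n / L) * L ≤ n + L
blockCount n L =
  ℕ.≤-trans (ℕ.≤-reflexive (m≡m%n+[m/n]*n n L)) (ℕ.+-monoˡ-≤ ((n / L) * L) (ℕ.<⇒≤ (m%n<n n L))) ,
  ℕ.≤-trans (ℕ.+-monoʳ-≤ L (m/n*n≤m n L)) (ℕ.≤-reflexive (ℕ.+-comm L n))

blocks-budget : ∀ {β L d n} → β * L ≤ n + L → d ≤ L + L → L ≤ d → β * d ≤ 2 * (n + d)
blocks-budget {β} {L} {d} {n} βL≤n+L d≤2L L≤d = begin
  β * d                  ≤⟨ ℕ.*-monoʳ-≤ β d≤2L ⟩
  β * (L + L)            ≡⟨ ℕ.*-distribˡ-+ β L L ⟩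
  β * L + β * L          ≤⟨ ℕ.+-mono-≤ βL≤n+L βL≤n+L ⟩
  (n + L) + (n + L)      ≤⟨ ℕ.+-mono-≤ n+L≤n+d n+L≤n+d ⟩
  (n + d) + (n + d)      ≡⟨ cong ((n + d) +_) (ℕ.+-identityʳ (n + d)) ⟨
  2 * (n + d)            ∎
  where
  open ℕ.≤-Reasoning
  n+L≤n+d = ℕ.+-monoʳ-≤ n L≤d

2^[q*d]≤b^N : ∀ {q β w d b N} .{{_ : NonZero b}} → q ≤ β * w → 2 ^ w ≤ b → β * d ≤ N → 2 ^ (q * d) ≤ b ^ N
2^[q*d]≤b^N {q} {β} {w} {d} {b} {N} q≤βw 2^w≤b βd≤N = begin
  2 ^ (q * d)            ≤⟨ ℕ.^-monoʳ-≤ 2 (ℕ.*-monoˡ-≤ d q≤βw) ⟩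
  2 ^ (β * w * d)        ≡⟨ cong (2 ^_) (regroup β w d) ⟩
  2 ^ (w * (β * d))      ≡⟨ ℕ.^-*-assoc 2 w (β * d) ⟨
  (2 ^ w) ^ (β * d)      ≤⟨ ℕ.^-monoˡ-≤ (β * d) 2^w≤b ⟩
  b ^ (β * d)            ≤⟨ ℕ.^-monoʳ-≤ b βd≤N ⟩
  b ^ N                  ∎
  where
  open ℕ.≤-Reasoning
  regroup : ∀ β w d → β * w * d ≡ w * (β * d)
  regroup = ℕ.solve-∀

record Parameters (n d : ℕ) : Set where
  field
    L e β       : ℕ
    2L≤k        : L + L ≤ 4 + d
    L≤2^e       : L ≤ 2 ^ e
    n≤βL        : n ≤ β * L
    βd≤2[n+d]   : β * d ≤ 2 * (n + d)
    2^[2+e]≤16k : 2 ^ (2 + e) ≤ 16 * (4 + d)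

parameters : ∀ n d → 1 ≤ d → Parameters n d
parameters n d 1≤d with halve d
... | zero  , d≤0  , _      = contradiction 1≤d (ℕ.≤⇒≯ d≤0)
... | suc h , d≤2L , 2L≤1+d with 2^-between (suc h)
...   | e , L≤2^e , 2^e≤1+2L = record
  { L           = suc h
  ; e           = e
  ; β           = suc (n / suc h)
  ; 2L≤k        = ℕ.≤-trans 2L≤1+d (ℕ.m≤n+m (suc d) 3)
  ; L≤2^e       = L≤2^e
  ; n≤βL        = proj₁ (blockCount n (suc h))
  ; βd≤2[n+d]   = blocks-budget {β = suc (n / suc h)} (proj₂ (blockCount n (suc h))) d≤2L L≤d
  ; 2^[2+e]≤16k = begin
      2 * (2 * 2 ^ e)      ≤⟨ ℕ.*-monoʳ-≤ 2 (ℕ.*-monoʳ-≤ 2 2^e≤k) ⟩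
      2 * (2 * (4 + d))    ≡⟨ ℕ.*-assoc 2 2 (4 + d) ⟨
      4 * (4 + d)          ≤⟨ ℕ.*-monoˡ-≤ (4 + d) (ℕ.m≤m+n 4 12) ⟩
      16 * (4 + d)         ∎
  }
  where
  open ℕ.≤-Reasoning
  L≤d : suc h ≤ d
  L≤d = ℕ.≤-trans (ℕ.m≤n+m (suc h) h) (ℕ.≤-pred 2L≤1+d)
  2^e≤k : 2 ^ e ≤ 4 + d
  2^e≤k = ℕ.≤-trans 2^e≤1+2L (ℕ.≤-trans (s≤s 2L≤1+d) (ℕ.m≤n+m (suc (suc d)) 2))

mainTheorem5 : (n k : ℕ) → 1 ≤ n → 5 ≤ k →
    Σ (Algorithm n k) λ A → (x : Vec Bool n) →
      (run A x ≡ MAJ x) × WithinBound n k (queries A x)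
mainTheorem5 n (suc (suc (suc (suc d)))) _ (s≤s (s≤s (s≤s (s≤s 1≤d)))) =
  majority β , λ x → majority-correct β x n≤βL
                   , 2^[q*d]≤b^N {β = β} {w = 2 + e} (majority-queries β x) 2^[2+e]≤16k βd≤2[n+d]
  where
  open Parameters (parameters n d 1≤d)
  open Majority n (4 + d) L e 2L≤k L≤2^e
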